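{- No $12\times 12$ log-Hadamard matrix over $\mathbb{Z}_2$ has rank (over $\mathbb{Z}_2$) less than $10$. Consequently, for every $d\le 9$ there is no spectral subset of $\mathbb{Z}_2^d$ of size $12$.
   Context: A vector with entries in $\mathbb{Z}_2$ is equidistributed if $0$ and $1$ appear the same number of times among its entries. A square matrix with entries in $\mathbb{Z}_2$ is log-Hadamard if the difference of any two distinct rows is an equidistributed vector. A nonempty subset $E\subseteq\mathbb{Z}_2^d$ is spectral if there is $\Lambda\subseteq\mathbb{Z}_2^d$ such that the functions $x\mapsto(-1)^{\lambda\cdot x}$, $\lambda\in\Lambda$, restricted to $E$, form an orthogonal basis of the space of all functions $E\to\mathbb{C}$ with inner product $\langle f,g\rangle=\sum_{x\in E}f(x)\overline{g(x)}$; here $\lambda\cdot x=\sum_i\lambda_ix_i$. -}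

module Defs where

open import Data.Bool using (Bool; true; false; _xor_; _∧_; if_then_else_)
open import Data.Nat using (ℕ; zero; suc)
open import Data.Fin using (Fin; zero; suc)
open import Data.Vec using (Vec; []; _∷_; zipWith; replicate; lookup)
open import Data.Integer as ℤ using (ℤ)
open import Data.Rational as ℚ using (ℚ)
open import Data.Product using (Σ; ∃; _×_; _,_)
open import Relation.Binary.PropositionalEquality using (_≡_; _≢_)
open import Relation.Nullary using (¬_)
open import Function.Definitions using (Injective)

-- ℤ₂ is modelled by Bool (false = 0, true = 1, xor = addition, ∧ = multiplication).
-- ℤ₂^n is modelled by Vec Bool n.

countOnes : ∀ {n} → Vec Bool n → ℕ
countOnes [] = 0
countOnes (true ∷ v) = suc (countOnes v)
countOnes (false ∷ v) = countOnes v

countZeros : ∀ {n} → Vec Bool n → ℕ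
countZeros [] = 0
countZeros (true ∷ v) = countZeros v
countZeros (false ∷ v) = suc (countZeros v)

Equidistributed : ∀ {n} → Vec Bool n → Set
Equidistributed v = countOnes v ≡ countZeros v

-- difference (= sum) of vectors over ℤ₂
_⊕_ : ∀ {n} → Vec Bool n → Vec Bool n → Vec Bool n
_⊕_ = zipWith _xor_

Matrix : ℕ → Set
Matrix n = Fin n → Vec Bool n

LogHadamard : ∀ {n} → Matrix n → Set
LogHadamard {n} M = (i j : Fin n) → i ≢ j → Equidistributed (M i ⊕ M j)

linComb : ∀ {r n} → (Fin r → Bool) → (Fin r → Vec Bool n) → Vec Bool n
linComb {zero} {n} c v = replicate n false
linComb {suc r} c v =
  (if c zero then v zero else replicate _ false) ⊕ linComb (λ k → c (suc k)) (λ k → v (suc k))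

LinIndep : ∀ {r n} → (Fin r → Vec Bool n) → Set
LinIndep {r} {n} v = (c : Fin r → Bool) → linComb c v ≡ replicate n false → (k : Fin r) → c k ≡ false

-- rank (over ℤ₂) of M is at least r : some r distinct rows are linearly independent
-- (rank = maximal number of linearly independent rows)
RankAtLeast : ∀ {n} → ℕ → Matrix n → Set
RankAtLeast {n} r M = Σ (Fin r → Fin n) λ f → Injective _≡_ _≡_ f × LinIndep (λ k → M (f k))

RankLessThan : ∀ {n} → ℕ → Matrix n → Set
RankLessThan r M = ¬ RankAtLeast r M

dot : ∀ {d} → Vec Bool d → Vec Bool d → Bool
dot [] [] = false
dot (a ∷ u) (b ∷ v) = (a ∧ b) xor dot u v

sign : Bool → ℤ
sign false = ℤ.+ 1
sign true = ℤ.- (ℤ.+ 1)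

sumℤ : ∀ {n} → (Fin n → ℤ) → ℤ
sumℤ {zero} f = ℤ.+ 0
sumℤ {suc n} f = f zero ℤ.+ sumℤ (λ k → f (suc k))

sumℚ : ∀ {n} → (Fin n → ℚ) → ℚ
sumℚ {zero} f = ℚ.0ℚ
sumℚ {suc n} f = f zero ℚ.+ sumℚ (λ k → f (suc k))

χ : ∀ {d} → Vec Bool d → Vec Bool d → ℤ
χ l x = sign (dot l x)

-- A subset E ⊆ ℤ₂^d of size n is given by an injective enumeration
-- E : Fin n → Vec Bool d; functions E → 𝔽 are functions Fin n → 𝔽.
-- Inner product ⟨f,g⟩ = Σ_{x∈E} f x * conj (g x); characters are real (±1).
innerχ : ∀ {n d} → (Fin n → Vec Bool d) → Vec Bool d → Vec Bool d → ℤ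
innerχ E l l' = sumℤ (λ x → χ l (E x) ℤ.* χ l' (E x))

Spectral : ∀ {n d} → (Fin n → Vec Bool d) → Set
Spectral {n} {d} E =
  Σ ℕ λ m → Σ (Fin m → Vec Bool d) λ Λ →
    Injective _≡_ _≡_ Λ
    × ((i j : Fin m) → i ≢ j → innerχ E (Λ i) (Λ j) ≡ ℤ.+ 0)
    × ((f : Fin n → ℚ) → Σ (Fin m → ℚ) λ c →
         (x : Fin n) → f x ≡ sumℚ (λ i → c i ℚ.* (χ (Λ i) (E x) ℚ./ 1)))

{-# OPTIONS --safe #-}
module Submission where

-- Reducing ∣u∣ + ∣v∣ = ∣u ⊕ v∣ + 2 ∣u ∧ v∣ modulo 4 expresses u · v through the two
-- lowest binary digits of the weights ∣u∣, ∣v∣ and ∣u ⊕ v∣. In a log-Hadamard matrix of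
-- order n ≡ 4 (mod 8) every ∣Mᵢ ⊕ Mⱼ∣ = n/2 ≡ 2 (mod 4), so all rows have the same weight
-- parity and the Gram matrix over ℤ₂ is I + h 1ᵀ + 1 hᵀ + ℓ J. Dotting a linear relation
-- among n − 2 rows with every row shows that its coefficients are the values of an affine
-- map at h, which vanishes at the h-values of the two omitted rows. Omitting two rows with
-- different h-values (any two if h is constant) makes it vanish identically: rank M ≥ n − 2.
--
-- For a spectral E ⊆ ℤ₂^d with spectrum Λ, orthogonality of two characters on E says that
-- the corresponding rows of the matrix (λ · x) differ in exactly half of the places, so
-- this matrix is log-Hadamard once ∣Λ∣ = ∣E∣; its rank is at most d because its rows are
-- linear images of the λ. Hence d ≥ ∣E∣ − 2 whenever ∣E∣ ≡ 4 (mod 8).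

open import Defs
open import Algebra.Bundles using (CommutativeMonoid; Ring; CommutativeRing)
import Algebra.Properties.CommutativeMonoid.Sum as CommutativeMonoidSum
import Algebra.Properties.CommutativeSemigroup as CommutativeSemigroupProperties
import Algebra.Properties.Monoid.Mult as MonoidMult
import Algebra.Properties.Ring as RingProperties
import Algebra.Properties.Semiring.Sum as SemiringSum
open import Data.Bool using (Bool; true; false; not; _xor_; _∧_; if_then_else_)
open import Data.Bool.Properties
  using (xor-∧-commutativeRing; xor-same; xor-identityʳ; ∧-distribʳ-xor; ∧-zeroʳ; ∧-identityʳ; ∧-idem;
         not-involutive; ¬-not)
  renaming (_≟_ to _≟ᴮ_)
open import Data.Bool.Solver using (module xor-∧-Solver)
open import Data.Empty using (⊥-elim)
open import Data.Fin using (Fin; zero; suc; punchIn; combine; remQuot; _≟_)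
import Data.Fin.Properties as Fin
open import Data.Fin.Properties
  using (punchInᵢ≢i; punchIn-injective; any?; 2↔Bool; combine-remQuot; remQuot-combine; injective⇒≤)
open import Data.Integer as ℤ using (ℤ)
import Data.Integer.Properties as ℤ
open import Data.Nat using (ℕ; zero; suc; _^_; _≤_; s≤s; z≤n)
open import Data.Nat.Properties using (+-suc; suc-injective; ^-monoʳ-<; ≮⇒≥; ≤⇒≯)
open import Data.Nat.Solver using (module +-*-Solver)
open import Data.Product as Product using (Σ; ∃; _,_)
open import Data.Rational as ℚ using (ℚ; 0ℚ; 1ℚ)
import Data.Rational.Properties as ℚ
open import Data.Sum using (_⊎_; inj₁; inj₂)
open import Data.Vec using (Vec; []; _∷_; replicate; tabulate; lookup)
open import Data.Vec.Functional using (Vector)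
open import Data.Vec.Properties using (lookup-zipWith; lookup-replicate; lookup∘tabulate)
open import Data.Vec.Relation.Binary.Pointwise.Extensional using (ext; Pointwise-≡⇒≡)
open import Function using (_∘_)
open import Function.Bundles using (Inverse)
open import Function.Definitions using (Injective)
open import Relation.Binary.PropositionalEquality as ≡ using (_≡_; _≢_; refl)
import Relation.Binary.Reasoning.Setoid as SetoidReasoning
open import Relation.Nullary using (¬_)
open import Relation.Nullary.Decidable using (does; dec-true; dec-false; yes; no; ¬?; decidable-stable)

module _ {c ℓ} (M : CommutativeMonoid c ℓ) where
  open CommutativeMonoid M
  open CommutativeMonoidSum M

  sum-single : ∀ {n} (t : Vector Carrier n) i → (∀ k → k ≢ i → t k ≈ ε) → sum t ≈ t i
  sum-single {suc n} t i t≈ε = begin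
    sum t                             ≈⟨ sum-remove t ⟩
    t i ∙ sum (t ∘ punchIn i)         ≈⟨ ∙-congˡ (sum-cong-≋ (λ k → t≈ε (punchIn i k) (punchInᵢ≢i i k))) ⟩
    t i ∙ sum {n} (λ _ → ε)           ≈⟨ ∙-congˡ (sum-replicate-zero n) ⟩
    t i ∙ ε                           ≈⟨ identityʳ (t i) ⟩
    t i                               ∎
    where open SetoidReasoning setoid

module Signs {c ℓ} (R : Ring c ℓ) where
  open Ring R hiding (zero)
  open RingProperties R
  open SemiringSum semiring
  open MonoidMult +-monoid using (_×_)
  open SetoidReasoning setoid

  sgn : Bool → Carrier
  sgn false = 1#
  sgn true  = - 1#

  sgn-xor : ∀ a b → sgn a * sgn b ≈ sgn (a xor b)
  sgn-xor false b     = *-identityˡ (sgn b)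
  sgn-xor true  false = *-identityʳ (- 1#)
  sgn-xor true  true  = trans (-1*x≈-x (- 1#)) (-‿involutive 1#)

  sum-sgn : ∀ {n} (w : Fin n → Bool) →
            sum (sgn ∘ w) + countOnes (tabulate w) × 1# ≈ countZeros (tabulate w) × 1#
  sum-sgn {zero}  w = +-identityˡ 0#
  sum-sgn {suc n} w with w zero | sum-sgn (w ∘ suc)
  ... | false | ih = trans (+-assoc 1# _ _) (+-congˡ ih)
  ... | true  | ih = begin
    (- 1# + s) + (1# + o)              ≈⟨ interchange (- 1#) s 1# o ⟩
    (- 1# + 1#) + (s + o)              ≈⟨ +-congʳ (-‿inverseˡ 1#) ⟩
    0# + (s + o)                       ≈⟨ +-identityˡ (s + o) ⟩
    s + o                              ≈⟨ ih ⟩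
    countZeros (tabulate (w ∘ suc)) × 1# ∎
    where
    open CommutativeSemigroupProperties +-commutativeSemigroup using (interchange)
    s o : Carrier
    s = sum (sgn ∘ w ∘ suc)
    o = countOnes (tabulate (w ∘ suc)) × 1#

  equidistributed⇒sum-sgn≈0 : ∀ {n} (w : Fin n → Bool) → Equidistributed (tabulate w) → sum (sgn ∘ w) ≈ 0#
  equidistributed⇒sum-sgn≈0 w ones≡zeros =
    +-identityˡ-unique _ _ (trans (sum-sgn w) (reflexive (≡.cong (_× 1#) (≡.sym ones≡zeros))))

module _ {c ℓ} (R : CommutativeRing c ℓ) where
  open CommutativeRing R hiding (zero)
  open SemiringSum semiring
  open MonoidMult +-monoid using (_×_)
  open CommutativeSemigroupProperties *-commutativeSemigroup using (x∙yz≈y∙zx; x∙yz≈z∙yx)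
  open SetoidReasoning setoid

  -- Expanding the indicator e₀ of the point zero in the basis gives q j zero = a j N,
  -- hence m = ∑ᵢ (q i zero)² = N ∑ᵢ a i (q i zero) = N e₀ zero = N.
  orthogonal-±1-basis-size : ∀ {m n} (q : Fin m → Fin (suc n) → Carrier) →
    (∀ i x → q i x * q i x ≈ 1#) →
    (∀ i j → i ≢ j → sum (λ x → q i x * q j x) ≈ 0#) →
    ((f : Fin (suc n) → Carrier) → ∃ λ (a : Fin m → Carrier) → ∀ x → f x ≈ sum (λ i → a i * q i x)) →
    m × 1# ≈ suc n × 1#
  orthogonal-±1-basis-size {m} {n} q q²≈1 orthogonal spans = begin
    m × 1#                              ≈⟨ sum-replicate m ⟨
    sum {m} (λ _ → 1#)                  ≈⟨ sum-cong-≋ (λ i → sym (q²≈1 i zero)) ⟩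
    sum (λ i → q i zero * q i zero)     ≈⟨ sum-cong-≋ (λ i → *-congˡ (coefficient i)) ⟩
    sum (λ i → q i zero * (a i * N))    ≈⟨ sum-cong-≋ (λ i → x∙yz≈z∙yx (q i zero) (a i) N) ⟩
    sum (λ i → N * (a i * q i zero))    ≈⟨ *-distribˡ-sum N (λ i → a i * q i zero) ⟨
    N * sum (λ i → a i * q i zero)      ≈⟨ *-congˡ (a-spans zero) ⟨
    N * 1#                              ≈⟨ *-identityʳ N ⟩
    N                                   ∎
    where
    N : Carrier
    N = suc n × 1#

    e₀ : Fin (suc n) → Carrier
    e₀ zero    = 1#
    e₀ (suc _) = 0#

    a : Fin m → Carrier
    a = Product.proj₁ (spans e₀)

    a-spans : ∀ x → e₀ x ≈ sum (λ i → a i * q i x)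
    a-spans = Product.proj₂ (spans e₀)

    norm : ∀ j → sum (λ x → q j x * q j x) ≈ N
    norm j = trans (sum-cong-≋ (q²≈1 j)) (sum-replicate (suc n))

    evaluate-at-zero : ∀ j → sum (λ x → q j x * e₀ x) ≈ q j zero
    evaluate-at-zero j = trans (sum-single +-commutativeMonoid _ zero off-zero) (*-identityʳ (q j zero))
      where
      off-zero : ∀ x → x ≢ zero → q j x * e₀ x ≈ 0#
      off-zero zero    x≢0 = ⊥-elim (x≢0 ≡.refl)
      off-zero (suc x) _   = zeroʳ (q j (suc x))

    coefficient : ∀ j → q j zero ≈ a j * N
    coefficient j = begin
      q j zero                                         ≈⟨ evaluate-at-zero j ⟨
      sum (λ x → q j x * e₀ x)                         ≈⟨ sum-cong-≋ (λ x → *-congˡ {q j x} (a-spans x)) ⟩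
      sum (λ x → q j x * sum (λ i → a i * q i x))      ≈⟨ sum-cong-≋ (λ x → *-distribˡ-sum (q j x) (λ i → a i * q i x)) ⟩
      sum (λ x → sum (λ i → q j x * (a i * q i x)))    ≈⟨ sum-cong-≋ (λ x → sum-cong-≋ (λ i → x∙yz≈y∙zx (q j x) (a i) (q i x))) ⟩
      sum (λ x → sum (λ i → a i * (q i x * q j x)))    ≈⟨ ∑-comm (λ x i → a i * (q i x * q j x)) ⟩
      sum (λ i → sum (λ x → a i * (q i x * q j x)))    ≈⟨ sum-cong-≋ (λ i → *-distribˡ-sum (a i) (λ x → q i x * q j x)) ⟨
      sum (λ i → a i * sum (λ x → q i x * q j x))      ≈⟨ sum-single +-commutativeMonoid _ j
                                                            (λ i i≢j → trans (*-congˡ (orthogonal i j i≢j)) (zeroʳ (a i))) ⟩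
      a j * sum (λ x → q j x * q j x)                  ≈⟨ *-congˡ (norm j) ⟩
      a j * N                                          ∎

open import Data.Nat using (_+_; _*_)
open Product using (_×_)

-- Linear algebra over ℤ₂

open SemiringSum (CommutativeRing.semiring xor-∧-commutativeRing)
  using (sum; sum-cong-≗; ∑-distrib-+; *-distribʳ-sum; sum-replicate-zero)
open CommutativeRing xor-∧-commutativeRing using (+-commutativeMonoid)

xor≡false⇒≡ : ∀ {a b} → a xor b ≡ false → a ≡ b
xor≡false⇒≡ {false} {false} _ = refl
xor≡false⇒≡ {true}  {true}  _ = refl

lookup-ext : ∀ {n} {u v : Vec Bool n} → (∀ i → lookup u i ≡ lookup v i) → u ≡ v
lookup-ext u≗v = Pointwise-≡⇒≡ (ext u≗v)

⊕-same : ∀ {n} (u : Vec Bool n) → u ⊕ u ≡ replicate n false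
⊕-same []      = refl
⊕-same (a ∷ u) = ≡.cong₂ _∷_ (xor-same a) (⊕-same u)

linComb-linear : ∀ {n} (φ : Vec Bool n → Bool) →
                 (∀ u v → φ (u ⊕ v) ≡ φ u xor φ v) → φ (replicate n false) ≡ false →
                 ∀ {r} (c : Fin r → Bool) vs → φ (linComb c vs) ≡ sum (λ k → c k ∧ φ (vs k))
linComb-linear φ additive φ0≡0 {zero}  c vs = φ0≡0
linComb-linear φ additive φ0≡0 {suc r} c vs =
  ≡.trans (additive _ _) (≡.cong₂ _xor_ (scale (c zero)) (linComb-linear φ additive φ0≡0 (c ∘ suc) (vs ∘ suc)))
  where
  scale : ∀ b → φ (if b then vs zero else replicate _ false) ≡ b ∧ φ (vs zero)
  scale true  = refl
  scale false = φ0≡0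

lookup-linComb : ∀ {r n} (c : Fin r → Bool) (vs : Fin r → Vec Bool n) i →
                 lookup (linComb c vs) i ≡ sum (λ k → c k ∧ lookup (vs k) i)
lookup-linComb c vs i = linComb-linear (λ v → lookup v i) (lookup-zipWith _xor_ i) (lookup-replicate i false) c vs

dot-⊕ˡ : ∀ {n} (u v w : Vec Bool n) → dot (u ⊕ v) w ≡ dot u w xor dot v w
dot-⊕ˡ []      []      []      = refl
dot-⊕ˡ (a ∷ u) (b ∷ v) (c ∷ w) =
  ≡.trans (≡.cong (((a xor b) ∧ c) xor_) (dot-⊕ˡ u v w)) (distrib a b c (dot u w) (dot v w))
  where
  open xor-∧-Solver
  distrib : ∀ a b c x y → ((a xor b) ∧ c) xor (x xor y) ≡ ((a ∧ c) xor x) xor ((b ∧ c) xor y)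
  distrib = solve 5 (λ a b c x y → ((a :+ b) :* c) :+ (x :+ y) := ((a :* c) :+ x) :+ ((b :* c) :+ y)) refl

dot-zeroˡ : ∀ {n} (w : Vec Bool n) → dot (replicate n false) w ≡ false
dot-zeroˡ []      = refl
dot-zeroˡ (_ ∷ w) = dot-zeroˡ w

dot-linComb : ∀ {r n} (c : Fin r → Bool) (vs : Fin r → Vec Bool n) w →
              dot (linComb c vs) w ≡ sum (λ k → c k ∧ dot (vs k) w)
dot-linComb c vs w = linComb-linear (λ v → dot v w) (λ u v → dot-⊕ˡ u v w) (dot-zeroˡ w) c vs

linComb-homo-xor : ∀ {r n} (a b : Fin r → Bool) (vs : Fin r → Vec Bool n) →
                   linComb (λ k → a k xor b k) vs ≡ linComb a vs ⊕ linComb b vs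
linComb-homo-xor a b vs = lookup-ext λ i → begin
  lookup (linComb (λ k → a k xor b k) vs) i                 ≡⟨ lookup-linComb _ vs i ⟩
  sum (λ k → (a k xor b k) ∧ lookup (vs k) i)               ≡⟨ sum-cong-≗ (λ k → ∧-distribʳ-xor (lookup (vs k) i) (a k) (b k)) ⟩
  sum (λ k → (a k ∧ lookup (vs k) i) xor (b k ∧ lookup (vs k) i))
                                                            ≡⟨ ∑-distrib-+ (λ k → a k ∧ lookup (vs k) i) (λ k → b k ∧ lookup (vs k) i) ⟩
  sum (λ k → a k ∧ lookup (vs k) i) xor sum (λ k → b k ∧ lookup (vs k) i)
                                                            ≡⟨ ≡.cong₂ _xor_ (lookup-linComb a vs i) (lookup-linComb b vs i) ⟨
  lookup (linComb a vs) i xor lookup (linComb b vs) i       ≡⟨ lookup-zipWith _xor_ i (linComb a vs) (linComb b vs) ⟨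
  lookup (linComb a vs ⊕ linComb b vs) i                    ∎
  where open ≡.≡-Reasoning

LinIndep⇒linComb-injective : ∀ {r n} {vs : Fin r → Vec Bool n} → LinIndep vs →
                             Injective _≡_ _≡_ (λ (c : Vec Bool r) → linComb (lookup c) vs)
LinIndep⇒linComb-injective {vs = vs} independent {a} {b} a≡b =
  lookup-ext λ k → xor≡false⇒≡ (independent _ dependent k)
  where
  dependent : linComb (λ k → lookup a k xor lookup b k) vs ≡ replicate _ false
  dependent = ≡.trans (linComb-homo-xor (lookup a) (lookup b) vs)
                      (≡.trans (≡.cong (_⊕ linComb (lookup b) vs) a≡b) (⊕-same _))

module _ where
  open Inverse 2↔Bool using (to; from; strictlyInverseˡ; strictlyInverseʳ)

  toFin : ∀ {n} → Vec Bool n → Fin (2 ^ n)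
  toFin []      = zero
  toFin (b ∷ v) = combine (from b) (toFin v)

  fromFin : ∀ {n} → Fin (2 ^ n) → Vec Bool n
  fromFin {zero}  _ = []
  fromFin {suc n} i = to (Product.proj₁ (remQuot {2} (2 ^ n) i)) ∷ fromFin {n} (Product.proj₂ (remQuot {2} (2 ^ n) i))

  fromFin-toFin : ∀ {n} (v : Vec Bool n) → fromFin (toFin v) ≡ v
  fromFin-toFin []              = refl
  fromFin-toFin {suc n} (b ∷ v) = ≡.cong₂ _∷_
    (≡.trans (≡.cong (to ∘ Product.proj₁) (remQuot-combine (from b) (toFin v))) (strictlyInverseˡ b))
    (≡.trans (≡.cong (fromFin {n} ∘ Product.proj₂) (remQuot-combine (from b) (toFin v))) (fromFin-toFin v))

  toFin-fromFin : ∀ {n} (i : Fin (2 ^ n)) → toFin (fromFin {n} i) ≡ i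
  toFin-fromFin {zero}  zero = refl
  toFin-fromFin {suc n} i    = ≡.trans
    (≡.cong₂ combine (strictlyInverseʳ (Product.proj₁ (remQuot {2} (2 ^ n) i)))
                     (toFin-fromFin {n} (Product.proj₂ (remQuot {2} (2 ^ n) i))))
    (combine-remQuot {2} (2 ^ n) i)

  toFin-injective : ∀ {n} → Injective _≡_ _≡_ (toFin {n})
  toFin-injective {x = u} {v} eq = ≡.trans (≡.sym (fromFin-toFin u)) (≡.trans (≡.cong fromFin eq) (fromFin-toFin v))

  fromFin-injective : ∀ {n} → Injective _≡_ _≡_ (fromFin {n})
  fromFin-injective {n} {i} {j} eq =
    ≡.trans (≡.sym (toFin-fromFin {n} i)) (≡.trans (≡.cong toFin eq) (toFin-fromFin {n} j))

LinIndep⇒≤ : ∀ {r d} (vs : Fin r → Vec Bool d) → LinIndep vs → r ≤ d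
LinIndep⇒≤ {r} {d} vs independent = ≮⇒≥ λ d<r → ≤⇒≯ 2^r≤2^d (^-monoʳ-< 2 (s≤s (s≤s z≤n)) d<r)
  where
  2^r≤2^d : 2 ^ r ≤ 2 ^ d
  2^r≤2^d = injective⇒≤ {f = λ i → toFin (linComb (lookup (fromFin {r} i)) vs)}
    (λ eq → fromFin-injective (LinIndep⇒linComb-injective independent (toFin-injective eq)))

-- Weights modulo 4

bit₀ bit₁ : ℕ → Bool
bit₀ zero    = false
bit₀ (suc n) = not (bit₀ n)
bit₁ zero    = false
bit₁ (suc n) = bit₁ n xor bit₀ n

weight₀ weight₁ : ∀ {n} → Vec Bool n → Bool
weight₀ []      = false
weight₀ (x ∷ v) = x xor weight₀ v
weight₁ []      = false
weight₁ (x ∷ v) = weight₁ v xor (x ∧ weight₀ v)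

weight₀≡bit₀ : ∀ {n} (v : Vec Bool n) → weight₀ v ≡ bit₀ (countOnes v)
weight₀≡bit₀ []          = refl
weight₀≡bit₀ (true  ∷ v) = ≡.cong not (weight₀≡bit₀ v)
weight₀≡bit₀ (false ∷ v) = weight₀≡bit₀ v

weight₁≡bit₁ : ∀ {n} (v : Vec Bool n) → weight₁ v ≡ bit₁ (countOnes v)
weight₁≡bit₁ []          = refl
weight₁≡bit₁ (true  ∷ v) = ≡.cong₂ _xor_ (weight₁≡bit₁ v) (weight₀≡bit₀ v)
weight₁≡bit₁ (false ∷ v) = ≡.trans (xor-identityʳ (weight₁ v)) (weight₁≡bit₁ v)

weight₀-⊕ : ∀ {n} (u v : Vec Bool n) → weight₀ (u ⊕ v) ≡ weight₀ u xor weight₀ v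
weight₀-⊕ []      []      = refl
weight₀-⊕ (x ∷ u) (y ∷ v) rewrite weight₀-⊕ u v = interchange x y (weight₀ u) (weight₀ v)
  where
  open xor-∧-Solver
  interchange : ∀ x y a b → (x xor y) xor (a xor b) ≡ (x xor a) xor (y xor b)
  interchange = solve 4 (λ x y a b → (x :+ y) :+ (a :+ b) := (x :+ a) :+ (y :+ b)) refl

-- ∣u∣ + ∣v∣ = ∣u ⊕ v∣ + 2 ∣u ∧ v∣ read modulo 4.
dot-weights : ∀ {n} (u v : Vec Bool n) →
              dot u v ≡ ((weight₁ (u ⊕ v) xor weight₁ u) xor weight₁ v) xor (weight₀ u ∧ weight₀ v)
dot-weights []      []      = refl
dot-weights (x ∷ u) (y ∷ v) rewrite dot-weights u v | weight₀-⊕ u v =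
  step x y (weight₀ u) (weight₀ v) (weight₁ (u ⊕ v)) (weight₁ u) (weight₁ v)
  where
  open xor-∧-Solver
  step : ∀ x y a b c d e →
         (x ∧ y) xor (((c xor d) xor e) xor (a ∧ b)) ≡
         (((c xor ((x xor y) ∧ (a xor b))) xor (d xor (x ∧ a))) xor (e xor (y ∧ b))) xor ((x xor a) ∧ (y xor b))
  step = solve 7 (λ x y a b c d e →
    (x :* y) :+ (((c :+ d) :+ e) :+ (a :* b)) :=
    (((c :+ ((x :+ y) :* (a :+ b))) :+ (d :+ (x :* a))) :+ (e :+ (y :* b))) :+ ((x :+ a) :* (y :+ b))) refl

dot-self : ∀ {n} (v : Vec Bool n) → dot v v ≡ weight₀ v
dot-self []      = refl
dot-self (x ∷ v) = ≡.cong₂ _xor_ (∧-idem x) (dot-self v)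

countOnes+countZeros : ∀ {n} (v : Vec Bool n) → countOnes v + countZeros v ≡ n
countOnes+countZeros []          = refl
countOnes+countZeros (true  ∷ v) = ≡.cong suc (countOnes+countZeros v)
countOnes+countZeros (false ∷ v) =
  ≡.trans (+-suc (countOnes v) (countZeros v)) (≡.cong suc (countOnes+countZeros v))

m+m≡n+n⇒m≡n : ∀ {m n} → m + m ≡ n + n → m ≡ n
m+m≡n+n⇒m≡n {zero}  {zero}  _  = refl
m+m≡n+n⇒m≡n {suc m} {suc n} eq = ≡.cong suc (m+m≡n+n⇒m≡n (suc-injective
  (≡.trans (≡.sym (+-suc m m)) (≡.trans (suc-injective eq) (+-suc n n)))))

equidistributed-weight : ∀ q (v : Vec Bool (4 + q * 8)) → Equidistributed v → countOnes v ≡ 2 + q * 4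
equidistributed-weight q v ones≡zeros = m+m≡n+n⇒m≡n
  (≡.trans (≡.cong (countOnes v +_) ones≡zeros) (≡.trans (countOnes+countZeros v) (halves q)))
  where
  open +-*-Solver
  halves : ∀ q → 4 + q * 8 ≡ (2 + q * 4) + (2 + q * 4)
  halves = solve 1 (λ q → con 4 :+ q :* con 8 := (con 2 :+ q :* con 4) :+ (con 2 :+ q :* con 4)) refl

bit₀-4+ : ∀ n → bit₀ (4 + n) ≡ bit₀ n
bit₀-4+ n = ≡.trans (not-involutive _) (not-involutive (bit₀ n))

bit₁-4+ : ∀ n → bit₁ (4 + n) ≡ bit₁ n
bit₁-4+ n with bit₀ n | bit₁ n
... | false | false = refl
... | false | true  = refl
... | true  | false = refl
... | true  | true  = refl

bit₀-2+q*4 : ∀ q → bit₀ (2 + q * 4) ≡ false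
bit₀-2+q*4 zero    = refl
bit₀-2+q*4 (suc q) = ≡.trans (bit₀-4+ (2 + q * 4)) (bit₀-2+q*4 q)

bit₁-2+q*4 : ∀ q → bit₁ (2 + q * 4) ≡ true
bit₁-2+q*4 zero    = refl
bit₁-2+q*4 (suc q) = ≡.trans (bit₁-4+ (2 + q * 4)) (bit₁-2+q*4 q)

-- Gram matrices I + h 1ᵀ + 1 hᵀ + ℓ J and log-Hadamard matrices

δ : ∀ {n} → Fin n → Fin n → Bool
δ i j = does (i ≟ j)

two-values-cover : ∀ {r} (h : Fin (2 + r) → Bool) → ∃ λ b → ∀ i → h i ≡ h zero ⊎ h i ≡ h (suc b)
two-values-cover h with any? (λ b → ¬? (h (suc b) ≟ᴮ h zero))
... | yes (b , hb≢h0) = b , covered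
  where
  covered : ∀ i → h i ≡ h zero ⊎ h i ≡ h (suc b)
  covered i with h i ≟ᴮ h zero
  ... | yes hi≡h0 = inj₁ hi≡h0
  ... | no  hi≢h0 = inj₂ (≡.trans (¬-not hi≢h0) (≡.sym (¬-not hb≢h0)))
... | no none = zero , inj₁ ∘ constant
  where
  constant : ∀ i → h i ≡ h zero
  constant zero    = refl
  constant (suc b) = decidable-stable (h (suc b) ≟ᴮ h zero) (λ hb≢h0 → none (b , hb≢h0))

module GramForm {r N} (v : Fin (2 + r) → Vec Bool N) (h : Fin (2 + r) → Bool) (ℓ : Bool)
                (gram : ∀ i j → dot (v i) (v j) ≡ δ i j xor ((h i xor h j) xor ℓ)) where

  module Dependency (f : Fin r → Fin (2 + r)) (c : Fin r → Bool)
                    (dependent : linComb c (v ∘ f) ≡ replicate N false) where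

    affine : Bool → Bool
    affine p = sum (λ k → c k ∧ h (f k)) xor (sum c ∧ (p xor ℓ))

    relation : ∀ a → sum (λ k → c k ∧ δ (f k) a) xor affine (h a) ≡ false
    relation a = begin
      sum (λ k → c k ∧ δ (f k) a) xor affine (h a)
        ≡⟨ ≡.cong (λ s → sum (λ k → c k ∧ δ (f k) a) xor (sum (λ k → c k ∧ h (f k)) xor s))
                  (*-distribʳ-sum (h a xor ℓ) c) ⟩
      sum (λ k → c k ∧ δ (f k) a) xor (sum (λ k → c k ∧ h (f k)) xor sum (λ k → c k ∧ (h a xor ℓ)))
        ≡⟨ ≡.cong (sum (λ k → c k ∧ δ (f k) a) xor_) (∑-distrib-+ (λ k → c k ∧ h (f k)) (λ k → c k ∧ (h a xor ℓ))) ⟨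
      sum (λ k → c k ∧ δ (f k) a) xor sum (λ k → (c k ∧ h (f k)) xor (c k ∧ (h a xor ℓ)))
        ≡⟨ ∑-distrib-+ (λ k → c k ∧ δ (f k) a) (λ k → (c k ∧ h (f k)) xor (c k ∧ (h a xor ℓ))) ⟨
      sum (λ k → (c k ∧ δ (f k) a) xor ((c k ∧ h (f k)) xor (c k ∧ (h a xor ℓ))))
        ≡⟨ sum-cong-≗ (λ k → ≡.trans (distrib (c k) (δ (f k) a) (h (f k)) (h a) ℓ)
                                      (≡.cong (c k ∧_) (≡.sym (gram (f k) a)))) ⟩
      sum (λ k → c k ∧ dot (v (f k)) (v a))
        ≡⟨ dot-linComb c (v ∘ f) (v a) ⟨
      dot (linComb c (v ∘ f)) (v a)
        ≡⟨ ≡.cong (λ u → dot u (v a)) dependent ⟩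
      dot (replicate N false) (v a)
        ≡⟨ dot-zeroˡ (v a) ⟩
      false ∎
      where
      open ≡.≡-Reasoning
      open xor-∧-Solver
      distrib : ∀ c d p q l → (c ∧ d) xor ((c ∧ p) xor (c ∧ (q xor l))) ≡ c ∧ (d xor ((p xor q) xor l))
      distrib = solve 5 (λ c d p q l → (c :* d) :+ ((c :* p) :+ (c :* (q :+ l))) := c :* (d :+ ((p :+ q) :+ l))) refl

    coefficient : Injective _≡_ _≡_ f → ∀ j → c j ≡ affine (h (f j))
    coefficient f-injective j =
      xor≡false⇒≡ (≡.subst (λ s → s xor affine (h (f j)) ≡ false) picks-j (relation (f j)))
      where
      picks-j : sum (λ k → c k ∧ δ (f k) (f j)) ≡ c j
      picks-j = ≡.trans
        (sum-single +-commutativeMonoid _ j λ k k≢j →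
          ≡.trans (≡.cong (c k ∧_) (dec-false (f k ≟ f j) (k≢j ∘ f-injective))) (∧-zeroʳ (c k)))
        (≡.trans (≡.cong (c j ∧_) (dec-true (f j ≟ f j) refl)) (∧-identityʳ (c j)))

    affine-outside : ∀ a → (∀ k → f k ≢ a) → affine (h a) ≡ false
    affine-outside a outside = ≡.subst (λ s → s xor affine (h a) ≡ false) misses-a (relation a)
      where
      misses-a : sum (λ k → c k ∧ δ (f k) a) ≡ false
      misses-a = ≡.trans
        (sum-cong-≗ (λ k → ≡.trans (≡.cong (c k ∧_) (dec-false (f k ≟ a) (outside k))) (∧-zeroʳ (c k))))
        (sum-replicate-zero r)

  rank≥ : Σ (Fin r → Fin (2 + r)) λ f → Injective _≡_ _≡_ f × LinIndep (v ∘ f)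
  rank≥ = f , f-injective , independent
    where
    b : Fin (suc r)
    b = Product.proj₁ (two-values-cover h)

    f : Fin r → Fin (2 + r)
    f = suc ∘ punchIn b

    f-injective : Injective _≡_ _≡_ f
    f-injective eq = punchIn-injective b _ _ (Fin.suc-injective eq)

    independent : LinIndep (v ∘ f)
    independent c dependent k =
      ≡.trans (coefficient f-injective k) (vanishes (Product.proj₂ (two-values-cover h) (f k)))
      where
      open Dependency f c dependent
      vanishes : ∀ {p} → p ≡ h zero ⊎ p ≡ h (suc b) → affine p ≡ false
      vanishes (inj₁ refl) = affine-outside zero λ _ ()
      vanishes (inj₂ refl) = affine-outside (suc b) λ k eq → punchInᵢ≢i b k (Fin.suc-injective eq)

logHadamard-rank : ∀ q (M : Matrix (4 + q * 8)) → LogHadamard M → RankAtLeast (2 + q * 8) M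
logHadamard-rank q M logHadamard = GramForm.rank≥ M (weight₁ ∘ M) (not L) gram
  where
  L : Bool
  L = weight₀ (M zero)

  pair-weight : ∀ {i j} → i ≢ j → countOnes (M i ⊕ M j) ≡ 2 + q * 4
  pair-weight {i} {j} i≢j = equidistributed-weight q (M i ⊕ M j) (logHadamard i j i≢j)

  pair-weight₀ : ∀ {i j} → i ≢ j → weight₀ (M i ⊕ M j) ≡ false
  pair-weight₀ {i} {j} i≢j =
    ≡.trans (weight₀≡bit₀ (M i ⊕ M j)) (≡.trans (≡.cong bit₀ (pair-weight i≢j)) (bit₀-2+q*4 q))

  pair-weight₁ : ∀ {i j} → i ≢ j → weight₁ (M i ⊕ M j) ≡ true
  pair-weight₁ {i} {j} i≢j =
    ≡.trans (weight₁≡bit₁ (M i ⊕ M j)) (≡.trans (≡.cong bit₁ (pair-weight i≢j)) (bit₁-2+q*4 q))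

  same-parity : ∀ i → weight₀ (M i) ≡ L
  same-parity i with i ≟ zero
  ... | yes refl = refl
  ... | no  i≢0  = xor≡false⇒≡ (≡.trans (≡.sym (weight₀-⊕ (M i) (M zero))) (pair-weight₀ i≢0))

  gram : ∀ i j → dot (M i) (M j) ≡ δ i j xor ((weight₁ (M i) xor weight₁ (M j)) xor not L)
  gram i j with i ≟ j
  ... | yes refl = begin
    dot (M i) (M i)                                         ≡⟨ dot-self (M i) ⟩
    weight₀ (M i)                                           ≡⟨ same-parity i ⟩
    L                                                       ≡⟨ not-involutive L ⟨
    not (not L)                                             ≡⟨ ≡.cong (λ x → not (x xor not L)) (xor-same (weight₁ (M i))) ⟨
    true xor ((weight₁ (M i) xor weight₁ (M i)) xor not L)  ∎
    where open ≡.≡-Reasoning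
  ... | no i≢j = begin
    dot (M i) (M j)
      ≡⟨ dot-weights (M i) (M j) ⟩
    ((weight₁ (M i ⊕ M j) xor weight₁ (M i)) xor weight₁ (M j)) xor (weight₀ (M i) ∧ weight₀ (M j))
      ≡⟨ ≡.cong₂ (λ t s → ((t xor weight₁ (M i)) xor weight₁ (M j)) xor s)
                 (pair-weight₁ i≢j) (≡.cong₂ _∧_ (same-parity i) (same-parity j)) ⟩
    ((true xor weight₁ (M i)) xor weight₁ (M j)) xor (L ∧ L)
      ≡⟨ ≡.cong (((true xor weight₁ (M i)) xor weight₁ (M j)) xor_) (∧-idem L) ⟩
    ((true xor weight₁ (M i)) xor weight₁ (M j)) xor L
      ≡⟨ off-diagonal (weight₁ (M i)) (weight₁ (M j)) L ⟩
    false xor ((weight₁ (M i) xor weight₁ (M j)) xor not L) ∎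
    where
    open ≡.≡-Reasoning
    open xor-∧-Solver
    off-diagonal : ∀ p q l → ((true xor p) xor q) xor l ≡ (p xor q) xor (true xor l)
    off-diagonal = solve 3 (λ p q l → ((con true :+ p) :+ q) :+ l := (p :+ q) :+ (con true :+ l)) refl

-- Spectral sets

module ℤ-signs = Signs ℤ.+-*-ring
module ℚ-signs = Signs (CommutativeRing.ring ℚ.+-*-commutativeRing)
module ℤ-sum = SemiringSum (Ring.semiring ℤ.+-*-ring)
module ℚ-sum = SemiringSum (CommutativeRing.semiring ℚ.+-*-commutativeRing)
open MonoidMult (Ring.+-monoid ℤ.+-*-ring) using () renaming (_×_ to _×ℤ_)
open MonoidMult (CommutativeRing.+-monoid ℚ.+-*-commutativeRing) using () renaming (_×_ to _×ℚ_)

sumℤ≡sum : ∀ {n} (f : Fin n → ℤ) → sumℤ f ≡ ℤ-sum.sum f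
sumℤ≡sum {zero}  f = refl
sumℤ≡sum {suc n} f = ≡.cong (λ s → f zero ℤ.+ s) (sumℤ≡sum (f ∘ suc))

sumℚ≡sum : ∀ {n} (f : Fin n → ℚ) → sumℚ f ≡ ℚ-sum.sum f
sumℚ≡sum {zero}  f = refl
sumℚ≡sum {suc n} f = ≡.cong (λ s → f zero ℚ.+ s) (sumℚ≡sum (f ∘ suc))

sign≡sgn : ∀ b → sign b ≡ ℤ-signs.sgn b
sign≡sgn false = refl
sign≡sgn true  = refl

sign/1≡sgn : ∀ b → sign b ℚ./ 1 ≡ ℚ-signs.sgn b
sign/1≡sgn false = refl
sign/1≡sgn true  = refl

×1ℤ≡+ : ∀ n → n ×ℤ ℤ.+ 1 ≡ ℤ.+ n
×1ℤ≡+ zero    = refl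
×1ℤ≡+ (suc n) = ≡.cong (λ s → ℤ.+ 1 ℤ.+ s) (×1ℤ≡+ n)

×1ℚ-nonNegative : ∀ n → 0ℚ ℚ.≤ n ×ℚ 1ℚ
×1ℚ-nonNegative zero    = ℚ.≤-refl
×1ℚ-nonNegative (suc n) = ℚ.+-mono-≤ (ℚ.nonNegative⁻¹ 1ℚ) (×1ℚ-nonNegative n)

suc×1ℚ≢0 : ∀ n → suc n ×ℚ 1ℚ ≢ 0ℚ
suc×1ℚ≢0 n eq with ≡.subst (1ℚ ℚ.≤_) eq (ℚ.+-monoʳ-≤ 1ℚ (×1ℚ-nonNegative n))
... | ℚ.*≤* (ℤ.+≤+ ())

×1ℚ-injective : ∀ {m n} → m ×ℚ 1ℚ ≡ n ×ℚ 1ℚ → m ≡ n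
×1ℚ-injective {zero}  {zero}  _  = refl
×1ℚ-injective {zero}  {suc n} eq = ⊥-elim (suc×1ℚ≢0 n (≡.sym eq))
×1ℚ-injective {suc m} {zero}  eq = ⊥-elim (suc×1ℚ≢0 m eq)
×1ℚ-injective {suc m} {suc n} eq = ≡.cong suc (×1ℚ-injective (+-cancelˡ 1ℚ _ _ eq))
  where open RingProperties ℚ.+-*-ring using (+-cancelˡ)

Orthogonal : ∀ {n m d} → (Fin n → Vec Bool d) → (Fin m → Vec Bool d) → Set
Orthogonal {m = m} E Λ = (i j : Fin m) → i ≢ j → innerχ E (Λ i) (Λ j) ≡ ℤ.+ 0

Complete : ∀ {n m d} → (Fin n → Vec Bool d) → (Fin m → Vec Bool d) → Set
Complete {n} {m} E Λ = (f : Fin n → ℚ) → Σ (Fin m → ℚ) λ c →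
  (x : Fin n) → f x ≡ sumℚ (λ i → c i ℚ.* (χ (Λ i) (E x) ℚ./ 1))

characterRow : ∀ {n d} → (Fin n → Vec Bool d) → Vec Bool d → Vec Bool n
characterRow E l = tabulate (λ x → dot l (E x))

characterRow-⊕ : ∀ {n d} (E : Fin n → Vec Bool d) l l′ →
                 characterRow E l ⊕ characterRow E l′ ≡ tabulate (λ x → dot l (E x) xor dot l′ (E x))
characterRow-⊕ E l l′ = lookup-ext λ x → ≡.trans (lookup-zipWith _xor_ x (characterRow E l) (characterRow E l′))
  (≡.trans (≡.cong₂ _xor_ (lookup∘tabulate _ x) (lookup∘tabulate _ x)) (≡.sym (lookup∘tabulate _ x)))

characterRow-linComb : ∀ {r n d} (E : Fin n → Vec Bool d) (c : Fin r → Bool) (vs : Fin r → Vec Bool d) →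
                       linComb c (characterRow E ∘ vs) ≡ characterRow E (linComb c vs)
characterRow-linComb E c vs = lookup-ext λ x → begin
  lookup (linComb c (characterRow E ∘ vs)) x           ≡⟨ lookup-linComb c (characterRow E ∘ vs) x ⟩
  sum (λ k → c k ∧ lookup (characterRow E (vs k)) x)   ≡⟨ sum-cong-≗ (λ k → ≡.cong (c k ∧_) (lookup∘tabulate _ x)) ⟩
  sum (λ k → c k ∧ dot (vs k) (E x))                   ≡⟨ dot-linComb c vs (E x) ⟨
  dot (linComb c vs) (E x)                             ≡⟨ lookup∘tabulate _ x ⟨
  lookup (characterRow E (linComb c vs)) x             ∎
  where open ≡.≡-Reasoning

characterRow-zero : ∀ {n d} (E : Fin n → Vec Bool d) → characterRow E (replicate d false) ≡ replicate n false
characterRow-zero E = lookup-ext λ x →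
  ≡.trans (lookup∘tabulate _ x) (≡.trans (dot-zeroˡ (E x)) (≡.sym (lookup-replicate x false)))

characterRows-independent⇒independent : ∀ {r n d} (E : Fin n → Vec Bool d) (vs : Fin r → Vec Bool d) →
                                         LinIndep (characterRow E ∘ vs) → LinIndep vs
characterRows-independent⇒independent E vs independent c dependent = independent c
  (≡.trans (characterRow-linComb E c vs) (≡.trans (≡.cong (characterRow E) dependent) (characterRow-zero E)))

orthogonal⇒equidistributed : ∀ {n d} (E : Fin n → Vec Bool d) l l′ → innerχ E l l′ ≡ ℤ.+ 0 →
                             Equidistributed (tabulate (λ x → dot l (E x) xor dot l′ (E x)))
orthogonal⇒equidistributed E l l′ inner≡0 = ℤ.+-injective (begin
  ℤ.+ countOnes (tabulate w)                               ≡⟨ ×1ℤ≡+ _ ⟨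
  countOnes (tabulate w) ×ℤ ℤ.+ 1                          ≡⟨ ℤ.+-identityˡ _ ⟨
  ℤ.+ 0 ℤ.+ countOnes (tabulate w) ×ℤ ℤ.+ 1                ≡⟨ ≡.cong (λ s → s ℤ.+ countOnes (tabulate w) ×ℤ ℤ.+ 1) sum≡0 ⟨
  ℤ-sum.sum (sgn ∘ w) ℤ.+ countOnes (tabulate w) ×ℤ ℤ.+ 1  ≡⟨ ℤ-signs.sum-sgn w ⟩
  countZeros (tabulate w) ×ℤ ℤ.+ 1                         ≡⟨ ×1ℤ≡+ _ ⟩
  ℤ.+ countZeros (tabulate w)                              ∎)
  where
  open ≡.≡-Reasoning
  open ℤ-signs using (sgn; sgn-xor)
  w : Fin _ → Bool
  w x = dot l (E x) xor dot l′ (E x)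
  sum≡0 : ℤ-sum.sum (sgn ∘ w) ≡ ℤ.+ 0
  sum≡0 = ≡.trans (ℤ-sum.sum-cong-≗ (λ x → ≡.trans (≡.sym (sgn-xor (dot l (E x)) (dot l′ (E x))))
                                              (≡.cong₂ ℤ._*_ (≡.sym (sign≡sgn (dot l (E x)))) (≡.sym (sign≡sgn (dot l′ (E x)))))))
                  (≡.trans (≡.sym (sumℤ≡sum (λ x → χ l (E x) ℤ.* χ l′ (E x)))) inner≡0)

characterRows-logHadamard : ∀ {n d} (E : Fin n → Vec Bool d) (Λ : Fin n → Vec Bool d) →
                            Orthogonal E Λ → LogHadamard (characterRow E ∘ Λ)
characterRows-logHadamard E Λ orthogonal i j i≢j = ≡.subst Equidistributed (≡.sym (characterRow-⊕ E (Λ i) (Λ j)))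
  (orthogonal⇒equidistributed E (Λ i) (Λ j) (orthogonal i j i≢j))

spectrum-size : ∀ {m n d} (E : Fin (suc n) → Vec Bool d) (Λ : Fin m → Vec Bool d) →
                Orthogonal E Λ → Complete E Λ → m ≡ suc n
spectrum-size E Λ orthogonal complete =
  ×1ℚ-injective (orthogonal-±1-basis-size ℚ.+-*-commutativeRing q q²≡1 q-orthogonal q-spans)
  where
  open ℚ-signs using (sgn; sgn-xor; equidistributed⇒sum-sgn≈0)
  q : Fin _ → Fin _ → ℚ
  q i x = sgn (dot (Λ i) (E x))

  q²≡1 : ∀ i x → q i x ℚ.* q i x ≡ 1ℚ
  q²≡1 i x = ≡.trans (sgn-xor (dot (Λ i) (E x)) (dot (Λ i) (E x))) (≡.cong sgn (xor-same (dot (Λ i) (E x))))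

  q-orthogonal : ∀ i j → i ≢ j → ℚ-sum.sum (λ x → q i x ℚ.* q j x) ≡ 0ℚ
  q-orthogonal i j i≢j = ≡.trans (ℚ-sum.sum-cong-≗ (λ x → sgn-xor (dot (Λ i) (E x)) (dot (Λ j) (E x))))
    (equidistributed⇒sum-sgn≈0 (λ x → dot (Λ i) (E x) xor dot (Λ j) (E x))
      (orthogonal⇒equidistributed E (Λ i) (Λ j) (orthogonal i j i≢j)))

  q-spans : ∀ f → ∃ λ c → ∀ x → f x ≡ ℚ-sum.sum (λ i → c i ℚ.* q i x)
  q-spans f with complete f
  ... | c , f≡ = c , λ x → ≡.trans (f≡ x)
    (≡.trans (sumℚ≡sum (λ i → c i ℚ.* (χ (Λ i) (E x) ℚ./ 1)))
      (ℚ-sum.sum-cong-≗ (λ i → ≡.cong (c i ℚ.*_) (sign/1≡sgn (dot (Λ i) (E x))))))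

orthogonal-dimension : ∀ q {d} (E Λ : Fin (4 + q * 8) → Vec Bool d) → Orthogonal E Λ → 2 + q * 8 ≤ d
orthogonal-dimension q E Λ orthogonal =
  LinIndep⇒≤ (Λ ∘ f) (characterRows-independent⇒independent E (Λ ∘ f) independent)
  where
  rank : RankAtLeast (2 + q * 8) (characterRow E ∘ Λ)
  rank = logHadamard-rank q (characterRow E ∘ Λ) (characterRows-logHadamard E Λ orthogonal)

  f : Fin (2 + q * 8) → Fin (4 + q * 8)
  f = Product.proj₁ rank

  independent : LinIndep (characterRow E ∘ Λ ∘ f)
  independent = Product.proj₂ (Product.proj₂ rank)

spectral-dimension : ∀ q {d} (E : Fin (4 + q * 8) → Vec Bool d) → Spectral E → 2 + q * 8 ≤ d
spectral-dimension q {d} E (_ , Λ , _ , orthogonal , complete) =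
  sized (spectrum-size E Λ orthogonal complete) Λ orthogonal
  where
  sized : ∀ {m} → m ≡ 4 + q * 8 → (Λ : Fin m → Vec Bool d) → Orthogonal E Λ → 2 + q * 8 ≤ d
  sized refl = orthogonal-dimension q E

mainTheorem7 : (¬ Σ (Matrix 12) (λ M → LogHadamard M × RankLessThan 10 M))
               × ((d : ℕ) → d ≤ 9 → (E : Fin 12 → Vec Bool d) → Injective _≡_ _≡_ E → ¬ Spectral E)
mainTheorem7 = (λ (M , logHadamard , rank<10) → rank<10 (logHadamard-rank 1 M logHadamard))
             , λ d d≤9 E _ spectral → ≤⇒≯ d≤9 (spectral-dimension 1 E spectral)
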